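{- Let $E'$ be a poset and $E$ a subposet of $E'$ (with the induced order). Then $\mathbb H_E$, viewed as a subset of $\mathbb H_{E'}$ (every condition of $\mathbb H_E$ is literally a condition of $\mathbb H_{E'}$), is a regular subordering of $\mathbb H_{E'}$.
   Context: For $n\in\mathbb N$, $\prod_{m<n}m$ denotes the set of functions $s\colon\{0,\dots,n-1\}\to\mathbb N$ with $s(0)=0$ and $s(m)<m$ for $1\le m<n$. For a poset $(P,\le_P)$, $\mathbb H_P$ consists of triples $p=(D_p,n_p,f_p)$ with $D_p\subseteq P$ finite, $n_p\in\mathbb N$, $f_p\colon D_p\to\prod_{m<n_p}m$; $p\le q$ iff $D_p\supseteq D_q$, $n_p\ge n_q$, $f_p(a)\restriction n_q=f_q(a)$ for $a\in D_q$, and for all $a,b\in D_q$ with $a\le_P b$, $f_p(a)(j)\le f_p(b)(j)$ for $n_q\le j<n_p$. A subordering $\mathbb Q\subseteq\mathbb P$ is regular (a complete suborder) if the inclusion preserves order and incompatibility and every maximal antichain of $\mathbb Q$ is a maximal antichain of $\mathbb P$; equivalently, for every $\mathbb P$-generic filter $G$, $G\cap\mathbb Q$ is $\mathbb Q$-generic. -}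

module Defs where

open import Data.Nat using (ℕ; zero; suc; _≤_; _<_)
open import Data.Fin using (Fin; toℕ; fromℕ<)
open import Data.List using (List)
open import Data.List.Membership.Propositional using (_∈_)
open import Data.List.Relation.Unary.All using (All)
open import Data.Product using (Σ; _×_; ∃; ∃-syntax)
open import Relation.Nullary using (¬_)
open import Relation.Binary.PropositionalEquality using (_≡_; _≢_)

-- Elements of ∏_{m<n} m : s : {0,…,n-1} → ℕ with s 0 = 0 and s m < m
-- for 1 ≤ m < n.

IsSeq : (n : ℕ) → (Fin n → ℕ) → Set
IsSeq n s = (∀ (i : Fin n) → toℕ i ≡ 0 → s i ≡ 0)
          × (∀ (i : Fin n) → 1 ≤ toℕ i → s i < toℕ i)

-- A condition is a triple (D, n, f) with D a finite subset of A (a list),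
-- n ∈ ℕ and f assigning to each a ∈ D an element of ∏_{m<n} m.
-- f is given as a total function on A; only its values on D matter
-- (the values off D play no role in the order).

module Hechler {A : Set} (_⊑_ : A → A → Set) where

  record Cond : Set where
    constructor cond
    field
      D     : List A
      n     : ℕ
      f     : A → Fin n → ℕ
      valid : ∀ a → a ∈ D → IsSeq n (f a)
  open Cond public

  _≤H_ : Cond → Cond → Set
  p ≤H q =
      (∀ a → a ∈ D q → a ∈ D p)
    × (n q ≤ n p)
    × (∀ a → a ∈ D q → ∀ j (j<nq : j < n q) (j<np : j < n p) →
         f p a (fromℕ< j<np) ≡ f q a (fromℕ< j<nq))
    × (∀ a b → a ∈ D q → b ∈ D q → a ⊑ b →
         ∀ j → n q ≤ j → (j<np : j < n p) →
         f p a (fromℕ< j<np) ≤ f p b (fromℕ< j<np))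

-- ℍ_E for a subset E ⊆ A with the induced order, viewed as a subset of
-- ℍ_A: the conditions with D ⊆ E.  Its order is the order of ℍ_A, which
-- coincides with the order of ℍ_E defined from the induced order on E
-- (the monotonicity clause only mentions a, b ∈ D_q ⊆ E).

  InSub : (A → Set) → Cond → Set
  InSub E p = All E (D p)

-- Regular (complete) suborders.  A forcing notion is a type with a
-- relation; a suborder is given by a predicate Q on it, carrying the
-- restricted order.

module Forcing {P : Set} (_≤_ : P → P → Set) where

  Compatible : P → P → Set
  Compatible p q = ∃[ r ] (r ≤ p × r ≤ q)

  CompatibleIn : (P → Set) → P → P → Set
  CompatibleIn Q p q = ∃[ r ] (Q r × r ≤ p × r ≤ q)

  MaximalAntichainIn : (P → Set) → (P → Set) → Set
  MaximalAntichainIn Q X =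
      (∀ x → X x → Q x)
    × (∀ x y → X x → X y → x ≢ y → ¬ CompatibleIn Q x y)
    × (∀ q → Q q → ∃[ x ] (X x × CompatibleIn Q q x))

  MaximalAntichain : (P → Set) → Set
  MaximalAntichain X =
      (∀ x y → X x → X y → x ≢ y → ¬ Compatible x y)
    × (∀ p → ∃[ x ] (X x × Compatible p x))

 -- Q (with the restricted order) is a regular subordering of P:
  -- the inclusion preserves incompatibility, and maximal antichains of Q
  -- are maximal antichains of P.  (Preservation of order is automatic,
  -- since Q carries the restriction of the order of P.)
  IsRegularSub : (P → Set) → Set₁
  IsRegularSub Q =
      (∀ p q → Q p → Q q → ¬ CompatibleIn Q p q → ¬ Compatible p q)
    × (∀ (X : P → Set) → MaximalAntichainIn Q X → MaximalAntichain X)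

{-# OPTIONS --safe #-}
-- A common extension r of p, q ∈ ℍ_E restricts to E (keep only the coordinates in E)
-- and still extends p and q; so incompatibility in ℍ_E is incompatibility in ℍ_E'.
-- For maximal antichains, reduce p ∈ ℍ_E' to p ↾ E ∈ ℍ_E: any r ∈ ℍ_E below p ↾ E
-- amalgamates with p into a condition of length n_r that agrees with r on E, with p
-- below n_p off E, and beyond n_p takes at a ∉ E the maximum of r's values at the
-- E-coordinates of p below a.  That maximum is what p's monotonicity demands, and the
-- amalgam extends everything r extends.
module Submission where

open import Defs
open import Level using (0ℓ)
open import Relation.Binary.PropositionalEquality using (_≡_; refl; sym; trans; subst; subst₂)
open import Relation.Binary.Structures using (IsPartialOrder)
open import Relation.Binary.Definitions using (Transitive)
open import Axiom.ExcludedMiddle using (ExcludedMiddle)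

open import Data.Nat using (ℕ; zero; suc; pred; _≤_; _<_; z≤n; s≤s; s≤s⁻¹; >-nonZero)
open import Data.Nat.Properties
  using (_<?_; ≤-reflexive; <-≤-trans; n≤0⇒n≡0; <⇒≱; ≮⇒≥; m≤pred[n]⇒suc[m]≤n)
open import Data.Fin using (Fin; toℕ; fromℕ<)
open import Data.Fin.Properties using (toℕ<n; toℕ-fromℕ<)
open import Data.List using (List; _++_; map; filter)
open import Data.List.Extrema.Nat using (max; xs≤max; max≤v⁺)
open import Data.List.Membership.Propositional using (_∈_)
open import Data.List.Membership.Propositional.Properties using (∈-map⁺; ∈-filter⁺; ∈-filter⁻; ∈-++⁻)
open import Data.List.Relation.Binary.Subset.Propositional using (_⊆_)
open import Data.List.Relation.Binary.Subset.Propositional.Properties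
  using (xs⊆xs++ys; xs⊆ys++xs; filter-⊆)
open import Data.List.Relation.Unary.All as All using ()
open import Data.List.Relation.Unary.All.Properties using (all-filter) renaming (map⁺ to All-map⁺)
open import Data.Product using (_,_; proj₁; proj₂)
open import Data.Sum using (inj₁; inj₂)
open import Function using (_∘_; case_of_)
open import Relation.Nullary using (¬_; Dec; yes; no; contradiction)

IsSeq⇒≤pred : ∀ {n} {s : Fin n → ℕ} → IsSeq n s → ∀ i → s i ≤ pred (toℕ i)
IsSeq⇒≤pred {s = s} (zero-at-0 , below) i with toℕ i in eq
... | zero  = ≤-reflexive (zero-at-0 i eq)
... | suc _ = s≤s⁻¹ (subst (s i <_) eq (below i (subst (1 ≤_) (sym eq) (s≤s z≤n))))

≤pred⇒IsSeq : ∀ {n} {s : Fin n → ℕ} → (∀ i → s i ≤ pred (toℕ i)) → IsSeq n s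
≤pred⇒IsSeq {s = s} bounded =
    (λ i i≡0 → n≤0⇒n≡0 (subst (λ k → s i ≤ pred k) i≡0 (bounded i)))
  , (λ i 0<i → m≤pred[n]⇒suc[m]≤n {{>-nonZero 0<i}} (bounded i))

-- Sequences of length len read as functions on ℕ, with junk value 0 from len on.
seqAt : (len : ℕ) → (Fin len → ℕ) → ℕ → ℕ
seqAt len s j with j <? len
... | yes j<len = s (fromℕ< j<len)
... | no _      = 0

seqAt-fromℕ< : ∀ {len} (s : Fin len → ℕ) {j} (j<len : j < len) → seqAt len s j ≡ s (fromℕ< j<len)
seqAt-fromℕ< {len} s {j} j<len with j <? len
... | yes _     = refl
... | no j≮len = contradiction j<len j≮len

module HechlerValues {A : Set} (_⊑_ : A → A → Set) where
  open Hechler _⊑_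

  BoundedOn : List A → ℕ → (A → ℕ → ℕ) → Set
  BoundedOn dom len g = ∀ {a} → a ∈ dom → ∀ {j} → j < len → g a j ≤ pred j

  at : Cond → A → ℕ → ℕ
  at p a = seqAt (n p) (f p a)

  at-fromℕ< : ∀ p a {j} (j<n : j < n p) → at p a j ≡ f p a (fromℕ< j<n)
  at-fromℕ< p a = seqAt-fromℕ< (f p a)

  at-bounded : ∀ p → BoundedOn (D p) (n p) (at p)
  at-bounded p {a} a∈D {j} j<n =
    subst₂ (λ x k → x ≤ pred k) (sym (at-fromℕ< p a j<n)) (toℕ-fromℕ< j<n)
      (IsSeq⇒≤pred (valid p a a∈D) (fromℕ< j<n))

  ≤H-agrees : ∀ r q → r ≤H q → ∀ {a} → a ∈ D q → ∀ {j} → j < n q → at r a j ≡ at q a j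
  ≤H-agrees r q (_ , nq≤nr , agree , _) {a} a∈D {j} j<nq =
    let j<nr = <-≤-trans j<nq nq≤nr in
    trans (at-fromℕ< r a j<nr) (trans (agree a a∈D j j<nq j<nr) (sym (at-fromℕ< q a j<nq)))

  ≤H-monotone : ∀ r q → r ≤H q → ∀ {a b} → a ∈ D q → b ∈ D q → a ⊑ b →
                ∀ {j} → n q ≤ j → j < n r → at r a j ≤ at r b j
  ≤H-monotone r _ (_ , _ , _ , mono) {a} {b} a∈D b∈D a⊑b {j} nq≤j j<nr =
    subst₂ _≤_ (sym (at-fromℕ< r a j<nr)) (sym (at-fromℕ< r b j<nr))
      (mono a b a∈D b∈D a⊑b j nq≤j j<nr)

  fromAt : (dom : List A) (len : ℕ) (g : A → ℕ → ℕ) → BoundedOn dom len g → Cond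
  fromAt dom len g bounded =
    cond dom len (λ a i → g a (toℕ i)) (λ a a∈D → ≤pred⇒IsSeq (λ i → bounded a∈D (toℕ<n i)))

  fromAt-≤H : ∀ {dom len g} (bounded : BoundedOn dom len g) q → D q ⊆ dom → n q ≤ len →
    (∀ {a} → a ∈ D q → ∀ {j} → j < n q → g a j ≡ at q a j) →
    (∀ {a b} → a ∈ D q → b ∈ D q → a ⊑ b → ∀ {j} → n q ≤ j → j < len → g a j ≤ g b j) →
    fromAt dom len g bounded ≤H q
  fromAt-≤H {g = g} _ q Dq⊆D nq≤n agree mono =
      (λ _ → Dq⊆D)
    , nq≤n
    , (λ a a∈D j j<nq j<n → subst (λ k → g a k ≡ f q a (fromℕ< j<nq)) (sym (toℕ-fromℕ< j<n))
                               (trans (agree a∈D j<nq) (at-fromℕ< q a j<nq)))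
    , (λ a b a∈D b∈D a⊑b j nq≤j j<n → subst (λ k → g a k ≤ g b k) (sym (toℕ-fromℕ< j<n))
                                         (mono a∈D b∈D a⊑b nq≤j j<n))

module Regularity (em : ExcludedMiddle 0ℓ) {A : Set} (_⊑_ : A → A → Set) where
  open Hechler _⊑_
  open Forcing _≤H_
  open HechlerValues _⊑_

  decide : (P : A → Set) → ∀ a → Dec (P a)
  decide P a = em

  maxBelow : (A → ℕ) → List A → A → ℕ
  maxBelow h L a = max 0 (map h (filter (decide (_⊑ a)) L))

  ≤maxBelow : ∀ h {L a c} → c ∈ L → c ⊑ a → h c ≤ maxBelow h L a
  ≤maxBelow h {a = a} c∈L c⊑a =
    All.lookup (xs≤max 0 _) (∈-map⁺ h (∈-filter⁺ (decide (_⊑ a)) c∈L c⊑a))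

  maxBelow-lub : ∀ h {L a k} → (∀ {c} → c ∈ L → c ⊑ a → h c ≤ k) → maxBelow h L a ≤ k
  maxBelow-lub h {a = a} bounded = max≤v⁺ z≤n (All-map⁺ (All.tabulate λ c∈ →
    let (c∈L , c⊑a) = ∈-filter⁻ (decide (_⊑ a)) c∈ in bounded c∈L c⊑a))

  _↾_ : Cond → (A → Set) → Cond
  p ↾ E = cond (filter (decide E) (D p)) (n p) (f p)
               (λ a a∈ → valid p a (filter-⊆ (decide E) (D p) a∈))

  ↾-InSub : ∀ p E → InSub E (p ↾ E)
  ↾-InSub p E = all-filter (decide E) (D p)

  ↾-≤H : ∀ {E} r q → InSub E q → r ≤H q → (r ↾ E) ≤H q
  ↾-≤H {E} _ _ q∈E (Dq⊆Dr , rest) =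
    (λ a a∈Dq → ∈-filter⁺ (decide E) (Dq⊆Dr a a∈Dq) (All.lookup q∈E a∈Dq)) , rest

  compatible⇒compatibleIn : ∀ {E} p q → InSub E p → InSub E q →
                            Compatible p q → CompatibleIn (InSub E) p q
  compatible⇒compatibleIn {E} p q p∈E q∈E (r , r≤p , r≤q) =
    r ↾ E , ↾-InSub r E , ↾-≤H r p p∈E r≤p , ↾-≤H r q q∈E r≤q

  module Amalgamation (⊑-trans : Transitive _⊑_) {E : A → Set} (p r : Cond)
                      (r∈E : InSub E r) (r≤p↾E : r ≤H (p ↾ E)) where

    below : A → ℕ → ℕ
    below a j = maxBelow (λ c → at r c j) (D (p ↾ E)) a

    ≤below : ∀ {a c} j → c ∈ D (p ↾ E) → c ⊑ a → at r c j ≤ below a j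
    ≤below j = ≤maxBelow (λ c → at r c j)

    below-lub : ∀ {a} j {k} → (∀ {c} → c ∈ D (p ↾ E) → c ⊑ a → at r c j ≤ k) → below a j ≤ k
    below-lub j = maxBelow-lub (λ c → at r c j)

    agrees-↾ : ∀ {a} → a ∈ D (p ↾ E) → ∀ {j} → j < n p → at r a j ≡ at p a j
    agrees-↾ = ≤H-agrees r (p ↾ E) r≤p↾E

    monotone-↾ : ∀ {a b} → a ∈ D (p ↾ E) → b ∈ D (p ↾ E) → a ⊑ b →
                 ∀ {j} → n p ≤ j → j < n r → at r a j ≤ at r b j
    monotone-↾ = ≤H-monotone r (p ↾ E) r≤p↾E

    value : A → ℕ → ℕ
    value a j with decide E a | j <? n p
    ... | yes _ | _        = at r a j
    ... | no _  | yes j<np = f p a (fromℕ< j<np)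
    ... | no _  | no _     = below a j

    value-inside : ∀ {a} j → E a → value a j ≡ at r a j
    value-inside {a} j a∈E with decide E a
    ... | yes _   = refl
    ... | no a∉E = contradiction a∈E a∉E

    value-outside-< : ∀ {a j} → ¬ E a → j < n p → value a j ≡ at p a j
    value-outside-< {a} {j} a∉E j<np with decide E a | j <? n p
    ... | yes a∈E | _       = contradiction a∈E a∉E
    ... | no _    | yes _   = refl
    ... | no _    | no j≮np = contradiction j<np j≮np

    value-outside-≥ : ∀ {a j} → ¬ E a → n p ≤ j → value a j ≡ below a j
    value-outside-≥ {a} {j} a∉E np≤j with decide E a | j <? n p
    ... | yes a∈E | _      = contradiction a∈E a∉E
    ... | no _    | yes j<np = contradiction np≤j (<⇒≱ j<np)
    ... | no _    | no _   = refl

    inside-∈D : ∀ {a} → a ∈ D p → E a → a ∈ D (p ↾ E)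
    inside-∈D = ∈-filter⁺ (decide E)

    ∈Dr-if-inside : ∀ {a} → a ∈ D r ++ D p → E a → a ∈ D r
    ∈Dr-if-inside a∈ a∈E with ∈-++⁻ (D r) a∈
    ... | inj₁ a∈Dr = a∈Dr
    ... | inj₂ a∈Dp = proj₁ r≤p↾E _ (inside-∈D a∈Dp a∈E)

    ∈Dp-if-outside : ∀ {a} → a ∈ D r ++ D p → ¬ E a → a ∈ D p
    ∈Dp-if-outside a∈ a∉E with ∈-++⁻ (D r) a∈
    ... | inj₁ a∈Dr = contradiction (All.lookup r∈E a∈Dr) a∉E
    ... | inj₂ a∈Dp = a∈Dp

    value-bounded : BoundedOn (D r ++ D p) (n r) value
    value-bounded {a} a∈ {j} j<nr = case decide E a of λ where
      (yes a∈E) → subst (_≤ pred j) (sym (value-inside j a∈E))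
                    (at-bounded r (∈Dr-if-inside a∈ a∈E) j<nr)
      (no a∉E) → case j <? n p of λ where
        (yes j<np) → subst (_≤ pred j) (sym (value-outside-< a∉E j<np))
                       (at-bounded p (∈Dp-if-outside a∈ a∉E) j<np)
        (no j≮np)  → subst (_≤ pred j) (sym (value-outside-≥ a∉E (≮⇒≥ j≮np)))
                       (below-lub j λ c∈ _ → at-bounded r (proj₁ r≤p↾E _ c∈) j<nr)

    amalgam : Cond
    amalgam = fromAt (D r ++ D p) (n r) value value-bounded

    amalgam≤ : ∀ x → r ≤H x → amalgam ≤H x
    amalgam≤ x r≤x@(Dx⊆Dr , nx≤nr , _) =
      fromAt-≤H value-bounded x (λ a∈Dx → xs⊆xs++ys (D r) (D p) (Dx⊆Dr _ a∈Dx)) nx≤nr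
        (λ a∈Dx j<nx → trans (value-inside _ (inside a∈Dx)) (≤H-agrees r x r≤x a∈Dx j<nx))
        (λ a∈Dx b∈Dx a⊑b nx≤j j<nr →
          subst₂ _≤_ (sym (value-inside _ (inside a∈Dx))) (sym (value-inside _ (inside b∈Dx)))
            (≤H-monotone r x r≤x a∈Dx b∈Dx a⊑b nx≤j j<nr))
      where
      inside : ∀ {a} → a ∈ D x → E a
      inside a∈Dx = All.lookup r∈E (Dx⊆Dr _ a∈Dx)

    amalgam≤p : amalgam ≤H p
    amalgam≤p =
      fromAt-≤H value-bounded p (xs⊆ys++xs (D p) (D r)) (proj₁ (proj₂ r≤p↾E)) agree mono
      where
      agree : ∀ {a} → a ∈ D p → ∀ {j} → j < n p → value a j ≡ at p a j
      agree {a} a∈Dp {j} j<np = case decide E a of λ where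
        (yes a∈E) → trans (value-inside j a∈E) (agrees-↾ (inside-∈D a∈Dp a∈E) j<np)
        (no a∉E)  → value-outside-< a∉E j<np
      mono : ∀ {a b} → a ∈ D p → b ∈ D p → a ⊑ b → ∀ {j} → n p ≤ j → j < n r → value a j ≤ value b j
      mono {a} {b} a∈Dp b∈Dp a⊑b {j} np≤j j<nr = case (decide E a , decide E b) of λ where
        (yes a∈E , yes b∈E) → subst₂ _≤_ (sym (value-inside j a∈E)) (sym (value-inside j b∈E))
                                  (monotone-↾ (inside-∈D a∈Dp a∈E) (inside-∈D b∈Dp b∈E) a⊑b np≤j j<nr)
        (yes a∈E , no b∉E) → subst₂ _≤_ (sym (value-inside j a∈E)) (sym (value-outside-≥ b∉E np≤j))
                                  (≤below j (inside-∈D a∈Dp a∈E) a⊑b)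
        (no a∉E , yes b∈E) → subst₂ _≤_ (sym (value-outside-≥ a∉E np≤j)) (sym (value-inside j b∈E))
                                  (below-lub j λ c∈ c⊑a →
                                    monotone-↾ c∈ (inside-∈D b∈Dp b∈E) (⊑-trans c⊑a a⊑b) np≤j j<nr)
        (no a∉E , no b∉E) → subst₂ _≤_ (sym (value-outside-≥ a∉E np≤j))
                                              (sym (value-outside-≥ b∉E np≤j))
                                  (below-lub j λ c∈ c⊑a → ≤below j c∈ (⊑-trans c⊑a a⊑b))

  compatibleIn-↾⇒compatible : Transitive _⊑_ → ∀ E p x →
                              CompatibleIn (InSub E) (p ↾ E) x → Compatible p x
  compatibleIn-↾⇒compatible ⊑-trans E p x (r , r∈E , r≤p↾E , r≤x) =
    amalgam , amalgam≤p , amalgam≤ x r≤x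
    where open Amalgamation ⊑-trans p r r∈E r≤p↾E

lemma4p7 : ExcludedMiddle 0ℓ →
    (A : Set) (_⊑_ : A → A → Set) → IsPartialOrder _≡_ _⊑_ →
    (E : A → Set) →
    Forcing.IsRegularSub (Hechler._≤H_ _⊑_) (Hechler.InSub _⊑_ E)
lemma4p7 em A _⊑_ po E = incompatibility-preserved , maximal-antichains-preserved
  where
  open Hechler _⊑_
  open Forcing _≤H_
  open Regularity em _⊑_

  incompatibility-preserved : ∀ p q → InSub E p → InSub E q →
                              ¬ CompatibleIn (InSub E) p q → ¬ Compatible p q
  incompatibility-preserved p q p∈E q∈E ¬compIn = ¬compIn ∘ compatible⇒compatibleIn p q p∈E q∈E

  maximal-antichains-preserved : ∀ X → MaximalAntichainIn (InSub E) X → MaximalAntichain X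
  maximal-antichains-preserved X (X⊆E , antichain , maximal) =
      (λ x y x∈X y∈X x≢y → incompatibility-preserved x y (X⊆E x x∈X) (X⊆E y y∈X)
                              (antichain x y x∈X y∈X x≢y))
    , λ p → let (x , x∈X , p↾E∥x) = maximal (p ↾ E) (↾-InSub p E) in
            x , x∈X , compatibleIn-↾⇒compatible (IsPartialOrder.trans po) E p x p↾E∥x
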